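{- For $1\le k\le n$, $CR(n,k)=CR(n,k-1)+CR(n-1,k-1)$. In particular $CR(n+1,1)=R_{n+1}+R_n=M_n$.
   Context: For $0\le k\le n$, $\mathcal{CR}(n,k)$ is the set of lattice paths from $(0,0)$ to $(n+k,0)$ such that (1) the first $2k$ steps lie in $\{(1,1),(1,-1)\}$; (2) the last $n-k$ steps lie in $\{(1,2),(1,0),(1,-2)\}$, with no step $(1,0)$ on the $x$-axis; (3) the path never goes below the $x$-axis; $CR(n,k)=|\mathcal{CR}(n,k)|$. $M_n$ (Motzkin number) is the number of lattice paths from $(0,0)$ to $(n,0)$ with steps in $\{(1,1),(1,0),(1,-1)\}$ never going below the $x$-axis; $R_n$ (Riordan number) is the number of such paths with no step $(1,0)$ on the $x$-axis. -}

module Defs where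

open import Data.Nat using (ℕ; zero; suc; _+_; _*_; _∸_)
open import Data.Bool using (Bool; true; false)
open import Data.List using (List; []; _∷_; length; filterᵇ; concatMap; map)
open import Data.Vec using (Vec; []; _∷_)
open import Data.Maybe using (Maybe; just; nothing)

allVecs : {A : Set} → List A → (m : ℕ) → List (Vec A m)
allVecs xs zero    = [] ∷ []
allVecs xs (suc m) = concatMap (λ x → map (x ∷_) (allVecs xs m)) xs

countVecs : {A : Set} → List A → (m : ℕ) → (Vec A m → Bool) → ℕ
countVecs xs m p = length (filterᵇ p (allVecs xs m))

data MStep : Set where
  up flat down : MStep

mSteps : List MStep
mSteps = up ∷ flat ∷ down ∷ []

-- walk from height h; nothing if the path goes below the x-axis
-- (and, when noFlat0 = true, if a flat step (1,0) lies on the x-axis)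
mWalk : Bool → {m : ℕ} → ℕ → Vec MStep m → Maybe ℕ
mWalk b h []                 = just h
mWalk b h (up ∷ s)           = mWalk b (suc h) s
mWalk b zero (down ∷ s)      = nothing
mWalk b (suc h) (down ∷ s)   = mWalk b h s
mWalk true zero (flat ∷ s)   = nothing
mWalk false zero (flat ∷ s)  = mWalk false zero s
mWalk b (suc h) (flat ∷ s)   = mWalk b (suc h) s

endsAt0 : Maybe ℕ → Bool
endsAt0 (just zero) = true
endsAt0 _           = false

M : ℕ → ℕ
M n = countVecs mSteps n (λ p → endsAt0 (mWalk false 0 p))

R : ℕ → ℕ
R n = countVecs mSteps n (λ p → endsAt0 (mWalk true 0 p))

-- CR(n,k): first 2k steps in {(1,1),(1,-1)}, last n-k steps in
-- {(1,2),(1,0),(1,-2)} with no (1,0) step on the x-axis, never below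
-- the x-axis, from (0,0) to (n+k,0).

data Step1 : Set where
  u1 d1 : Step1

data Step2 : Set where
  u2 f2 d2 : Step2

steps1 : List Step1
steps1 = u1 ∷ d1 ∷ []

steps2 : List Step2
steps2 = u2 ∷ f2 ∷ d2 ∷ []

walk1 : {m : ℕ} → ℕ → Vec Step1 m → Maybe ℕ
walk1 h []               = just h
walk1 h (u1 ∷ s)         = walk1 (suc h) s
walk1 zero (d1 ∷ s)      = nothing
walk1 (suc h) (d1 ∷ s)   = walk1 h s

walk2 : {m : ℕ} → ℕ → Vec Step2 m → Maybe ℕ
walk2 h []                     = just h
walk2 h (u2 ∷ s)               = walk2 (suc (suc h)) s
walk2 (suc (suc h)) (d2 ∷ s)   = walk2 h s
walk2 _ (d2 ∷ s)               = nothing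
walk2 zero (f2 ∷ s)            = nothing
walk2 (suc h) (f2 ∷ s)         = walk2 (suc h) s

walk12 : Maybe ℕ → {m : ℕ} → Vec Step2 m → Maybe ℕ
walk12 nothing  s = nothing
walk12 (just h) s = walk2 h s

isCR : {a b : ℕ} → Vec Step1 a → Vec Step2 b → Bool
isCR p q = endsAt0 (walk12 (walk1 0 p) q)

CR : ℕ → ℕ → ℕ
CR n k = length (filterᵇ (λ pq → isCR (Data.Product.proj₁ pq) (Data.Product.proj₂ pq))
                   (Data.List.cartesianProduct (allVecs steps1 (2 * k)) (allVecs steps2 (n ∸ k))))
  where import Data.Product

-- Let T₁ and T₂ be the transfer operators on height weights f : ℕ → ℕ of the
-- step sets {+1, −1} and {+2, 0, −2} (no flat step on the axis), so that
-- CR(n,k) = (T₁^{2k} T₂^{n−k} δ₀)(0).  Two steps ±1 either return to the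
-- starting height or make one step of the second kind, and this holds even at
-- the axis: T₁² = 1 + T₂.  Moreover T₁ and T₂ commute.  Hence
-- T₁^{2k+2} T₂^{n−k} = T₁^{2k} T₂^{n−k} + T₁^{2k} T₂^{n−k+1}, the recurrence.
-- Doubling heights turns Riordan paths from j into T₂-paths from 2j and Motzkin
-- paths from j into T₂-paths from 2j+1, so R_n = (T₂ⁿ δ₀)(0), M_n = (T₂ⁿ δ₁)(1),
-- and R_{n+1} + R_n = (T₁ T₂ⁿ δ₀)(1) = (T₂ⁿ T₁ δ₀)(1) = (T₂ⁿ δ₁)(1) = M_n.
module Submission where

open import Defs
open import Data.Nat using (ℕ; suc; _+_; _∸_; _≤_)
open import Data.Product using (_×_)
open import Relation.Binary.PropositionalEquality using (_≡_)

open import Data.Bool using (Bool; true; false; if_then_else_)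
open import Data.List using (List; []; _∷_; _++_; map; concatMap; cartesianProduct; length; filterᵇ)
open import Data.List.Properties using (map-++; map-∘; map-cong)
open import Data.Nat.ListAction using (sum)
open import Data.Nat.ListAction.Properties using (sum-++)
open import Data.Maybe using (Maybe; just; nothing; maybe′; _>>=_)
open import Data.Nat using (zero; _*_; _≡ᵇ_; s≤s)
open import Data.Nat.GeneralisedArithmetic using (fold)
open import Data.Nat.Properties using (+-comm; +-identityʳ; *-suc; +-∸-assoc)
open import Data.Nat.Tactic.RingSolver using (solve-∀)
open import Data.Product using (_,_; proj₁; proj₂)
open import Data.Vec using (Vec; []; _∷_)
open import Function using (_∘_)
open import Relation.Binary.Core using (_Preserves_⟶_)
open import Relation.Binary.PropositionalEquality
  using (refl; sym; trans; cong; cong₂; _≗_; module ≡-Reasoning)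

open ≡-Reasoning

sum-map-++ : {A : Set} (w : A → ℕ) (xs ys : List A) →
             sum (map w (xs ++ ys)) ≡ sum (map w xs) + sum (map w ys)
sum-map-++ w xs ys = trans (cong sum (map-++ w xs ys)) (sum-++ (map w xs) (map w ys))

sum-map-0 : {A : Set} (xs : List A) → sum (map (λ _ → 0) xs) ≡ 0
sum-map-0 []       = refl
sum-map-0 (x ∷ xs) = sum-map-0 xs

sum-map-concatMap : {A B : Set} (w : B → ℕ) (g : A → List B) (xs : List A) →
  sum (map w (concatMap g xs)) ≡ sum (map (λ x → sum (map w (g x))) xs)
sum-map-concatMap w g []       = refl
sum-map-concatMap w g (x ∷ xs) =
  trans (sum-map-++ w (g x) (concatMap g xs)) (cong (sum (map w (g x)) +_) (sum-map-concatMap w g xs))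

sum-map-allVecs-suc : {A : Set} (xs : List A) (m : ℕ) (w : Vec A (suc m) → ℕ) →
  sum (map w (allVecs xs (suc m))) ≡ sum (map (λ x → sum (map (w ∘ (x ∷_)) (allVecs xs m))) xs)
sum-map-allVecs-suc xs m w =
  trans (sum-map-concatMap w _ xs) (cong sum (map-cong (λ x → cong sum (sym (map-∘ (allVecs xs m)))) xs))

sum-map-cartesianProduct : {A B : Set} (w : A × B → ℕ) (xs : List A) (ys : List B) →
  sum (map w (cartesianProduct xs ys)) ≡ sum (map (λ x → sum (map (λ y → w (x , y)) ys)) xs)
sum-map-cartesianProduct w []       ys = refl
sum-map-cartesianProduct w (x ∷ xs) ys = begin
  sum (map w (map (x ,_) ys ++ cartesianProduct xs ys))
    ≡⟨ sum-map-++ w (map (x ,_) ys) (cartesianProduct xs ys) ⟩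
  sum (map w (map (x ,_) ys)) + sum (map w (cartesianProduct xs ys))
    ≡⟨ cong₂ _+_ (cong sum (sym (map-∘ ys))) (sum-map-cartesianProduct w xs ys) ⟩
  sum (map (λ x → sum (map (λ y → w (x , y)) ys)) (x ∷ xs)) ∎

δ : ℕ → ℕ → ℕ
δ t h = if t ≡ᵇ h then 1 else 0

length-filter-endsAt0 : {A : Set} (w : A → Maybe ℕ) (xs : List A) →
  length (filterᵇ (endsAt0 ∘ w) xs) ≡ sum (map (maybe′ (δ 0) 0 ∘ w) xs)
length-filter-endsAt0 w []       = refl
length-filter-endsAt0 w (x ∷ xs) with w x
... | just zero    = cong suc (length-filter-endsAt0 w xs)
... | just (suc h) = length-filter-endsAt0 w xs
... | nothing      = length-filter-endsAt0 w xs

maybe′-cong : {f g : ℕ → ℕ} → f ≗ g → (x : Maybe ℕ) → maybe′ f 0 x ≡ maybe′ g 0 x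
maybe′-cong f≗g (just h) = f≗g h
maybe′-cong f≗g nothing  = refl

sum-maybe′->>= : {B : Set} (f : ℕ → ℕ) (g : ℕ → B → Maybe ℕ) (ys : List B) (x : Maybe ℕ) →
  sum (map (λ y → maybe′ f 0 (x >>= λ h → g h y)) ys)
    ≡ maybe′ (λ h → sum (map (λ y → maybe′ f 0 (g h y)) ys)) 0 x
sum-maybe′->>= f g ys (just h) = refl
sum-maybe′->>= f g ys nothing  = sum-map-0 ys

transfer : {S : Set} → List S → (ℕ → S → Maybe ℕ) → (ℕ → ℕ) → ℕ → ℕ
transfer steps next f h = sum (map (λ s → maybe′ f 0 (next h s)) steps)

transfer-cong : {S : Set} (steps : List S) (next : ℕ → S → Maybe ℕ) →
                transfer steps next Preserves _≗_ ⟶ _≗_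
transfer-cong steps next f≗g h = cong sum (map-cong (λ s → maybe′-cong f≗g (next h s)) steps)

fold-cong : {B : (ℕ → ℕ) → ℕ → ℕ} → B Preserves _≗_ ⟶ _≗_ →
            {f g : ℕ → ℕ} → f ≗ g → (m : ℕ) → fold f B m ≗ fold g B m
fold-cong B-cong f≗g zero    = f≗g
fold-cong B-cong f≗g (suc m) = B-cong (fold-cong B-cong f≗g m)

fold-intertwine : {A B : (ℕ → ℕ) → ℕ → ℕ} (U : (ℕ → ℕ) → ℕ → ℕ) → B Preserves _≗_ ⟶ _≗_ →
                  (∀ f → U (A f) ≗ B (U f)) → ∀ f m → U (fold f A m) ≗ fold (U f) B m
fold-intertwine U B-cong UA≗BU f zero    h = refl
fold-intertwine U B-cong UA≗BU f (suc m) h =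
  trans (UA≗BU (fold f _ m) h) (B-cong (fold-intertwine U B-cong UA≗BU f m) h)

module _ {S : Set} (steps : List S) (next : ℕ → S → Maybe ℕ)
         (walk : ∀ {m} → ℕ → Vec S m → Maybe ℕ)
         (walk-[] : ∀ h → walk h [] ≡ just h)
         (walk-∷ : ∀ {m} h s (q : Vec S m) → walk h (s ∷ q) ≡ (next h s >>= λ h′ → walk h′ q))
         where

  sum-walks≡fold-transfer : ∀ f m h →
    sum (map (maybe′ f 0 ∘ walk h) (allVecs steps m)) ≡ fold f (transfer steps next) m h
  sum-walks≡fold-transfer f zero    h =
    trans (cong (λ x → maybe′ f 0 x + 0) (walk-[] h)) (+-identityʳ (f h))
  sum-walks≡fold-transfer f (suc m) h = begin
    sum (map (maybe′ f 0 ∘ walk h) (allVecs steps (suc m)))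
      ≡⟨ sum-map-allVecs-suc steps m _ ⟩
    sum (map (λ s → sum (map (λ q → maybe′ f 0 (walk h (s ∷ q))) qs)) steps)
      ≡⟨ cong sum (map-cong (λ s → cong sum (map-cong (cong (maybe′ f 0) ∘ walk-∷ h s) qs)) steps) ⟩
    sum (map (λ s → sum (map (λ q → maybe′ f 0 (next h s >>= λ h′ → walk h′ q)) qs)) steps)
      ≡⟨ cong sum (map-cong (λ s → sum-maybe′->>= f walk qs (next h s)) steps) ⟩
    transfer steps next (λ h′ → sum (map (maybe′ f 0 ∘ walk h′) qs)) h
      ≡⟨ transfer-cong steps next (sum-walks≡fold-transfer f m) h ⟩
    fold f (transfer steps next) (suc m) h ∎
    where qs = allVecs steps m

next₁ : ℕ → Step1 → Maybe ℕ
next₁ h       u1 = just (suc h)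
next₁ zero    d1 = nothing
next₁ (suc h) d1 = just h

next₂ : ℕ → Step2 → Maybe ℕ
next₂ h             u2 = just (suc (suc h))
next₂ zero          f2 = nothing
next₂ (suc h)       f2 = just (suc h)
next₂ (suc (suc h)) d2 = just h
next₂ _             d2 = nothing

nextM : Bool → ℕ → MStep → Maybe ℕ
nextM b     h       up   = just (suc h)
nextM true  zero    flat = nothing
nextM false zero    flat = just zero
nextM b     (suc h) flat = just (suc h)
nextM b     zero    down = nothing
nextM b     (suc h) down = just h

walk1-∷ : ∀ {m} h s (q : Vec Step1 m) → walk1 h (s ∷ q) ≡ (next₁ h s >>= λ h′ → walk1 h′ q)
walk1-∷ h       u1 q = refl
walk1-∷ zero    d1 q = refl
walk1-∷ (suc h) d1 q = refl

walk2-∷ : ∀ {m} h s (q : Vec Step2 m) → walk2 h (s ∷ q) ≡ (next₂ h s >>= λ h′ → walk2 h′ q)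
walk2-∷ h             u2 q = refl
walk2-∷ zero          f2 q = refl
walk2-∷ (suc h)       f2 q = refl
walk2-∷ zero          d2 q = refl
walk2-∷ (suc zero)    d2 q = refl
walk2-∷ (suc (suc h)) d2 q = refl

mWalk-∷ : ∀ b {m} h s (q : Vec MStep m) → mWalk b h (s ∷ q) ≡ (nextM b h s >>= λ h′ → mWalk b h′ q)
mWalk-∷ b     h       up   q = refl
mWalk-∷ true  zero    flat q = refl
mWalk-∷ false zero    flat q = refl
mWalk-∷ true  (suc h) flat q = refl
mWalk-∷ false (suc h) flat q = refl
mWalk-∷ b     zero    down q = refl
mWalk-∷ b     (suc h) down q = refl

transfer₁ transfer₂ : (ℕ → ℕ) → ℕ → ℕ
transfer₁ = transfer steps1 next₁
transfer₂ = transfer steps2 next₂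

transferM : Bool → (ℕ → ℕ) → ℕ → ℕ
transferM b = transfer mSteps (nextM b)

transfer₁-δ₀ : transfer₁ (δ 0) ≗ δ 1
transfer₁-δ₀ zero          = refl
transfer₁-δ₀ (suc zero)    = refl
transfer₁-δ₀ (suc (suc h)) = refl

transfer₁²≗id+transfer₂ : ∀ f → transfer₁ (transfer₁ f) ≗ λ h → f h + transfer₂ f h
transfer₁²≗id+transfer₂ f zero          = rearrange (f 2) (f 0)
  where rearrange : ∀ a b → a + (b + 0) + 0 ≡ b + (a + 0)
        rearrange = solve-∀
transfer₁²≗id+transfer₂ f (suc zero)    = rearrange (f 3) (f 1)
  where rearrange : ∀ a b → a + (b + 0) + (b + 0 + 0) ≡ b + (a + (b + 0))
        rearrange = solve-∀
transfer₁²≗id+transfer₂ f (suc (suc h)) = rearrange (f (4 + h)) (f (2 + h)) (f h)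
  where rearrange : ∀ a b c → a + (b + 0) + (b + (c + 0) + 0) ≡ b + (a + (b + (c + 0)))
        rearrange = solve-∀

transfer₁-transfer₂-comm : ∀ f → transfer₁ (transfer₂ f) ≗ transfer₂ (transfer₁ f)
transfer₁-transfer₂-comm f zero                = refl
transfer₁-transfer₂-comm f (suc zero)          = rearrange (f 4) (f 2) (f 0)
  where rearrange : ∀ a b c → a + (b + (c + 0)) + (b + 0 + 0) ≡ a + (b + 0) + (b + (c + 0) + 0)
        rearrange = solve-∀
transfer₁-transfer₂-comm f (suc (suc zero))    = rearrange (f 5) (f 3) (f 1)
  where rearrange : ∀ a b c → a + (b + (c + 0)) + (b + (c + 0) + 0) ≡ a + (b + 0) + (b + (c + 0) + (c + 0 + 0))
        rearrange = solve-∀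
transfer₁-transfer₂-comm f (suc (suc (suc h))) = rearrange (f (6 + h)) (f (4 + h)) (f (2 + h)) (f h)
  where rearrange : ∀ a b c d → a + (b + (c + 0)) + (b + (c + (d + 0)) + 0)
                                  ≡ a + (b + 0) + (b + (c + 0) + (c + (d + 0) + 0))
        rearrange = solve-∀

fold-transfer₁-2+ : ∀ f a →
  fold f transfer₁ (2 + a) ≗ λ h → fold f transfer₁ a h + fold (transfer₂ f) transfer₁ a h
fold-transfer₁-2+ f a h =
  trans (transfer₁²≗id+transfer₂ (fold f transfer₁ a) h)
        (cong (fold f transfer₁ a h +_)
              (fold-intertwine transfer₂ (transfer-cong steps1 next₁) (λ g → sym ∘ transfer₁-transfer₂-comm g) f a h))

transfer₂-even : ∀ f → transfer₂ f ∘ (_* 2) ≗ transferM true (f ∘ (_* 2))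
transfer₂-even f zero    = refl
transfer₂-even f (suc j) = refl

transfer₂-odd : ∀ f → transfer₂ f ∘ suc ∘ (_* 2) ≗ transferM false (f ∘ suc ∘ (_* 2))
transfer₂-odd f zero    = refl
transfer₂-odd f (suc j) = refl

δ₀≗δ₀-even : δ 0 ≗ δ 0 ∘ (_* 2)
δ₀≗δ₀-even zero    = refl
δ₀≗δ₀-even (suc j) = refl

δ₀≗δ₁-odd : δ 0 ≗ δ 1 ∘ suc ∘ (_* 2)
δ₀≗δ₁-odd zero    = refl
δ₀≗δ₁-odd (suc j) = refl

sum-walk1 : ∀ f m h → sum (map (maybe′ f 0 ∘ walk1 h) (allVecs steps1 m)) ≡ fold f transfer₁ m h
sum-walk1 = sum-walks≡fold-transfer steps1 next₁ walk1 (λ _ → refl) walk1-∷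

sum-walk2 : ∀ f m h → sum (map (maybe′ f 0 ∘ walk2 h) (allVecs steps2 m)) ≡ fold f transfer₂ m h
sum-walk2 = sum-walks≡fold-transfer steps2 next₂ walk2 (λ _ → refl) walk2-∷

sum-mWalk : ∀ b f m h → sum (map (maybe′ f 0 ∘ mWalk b h) (allVecs mSteps m)) ≡ fold f (transferM b) m h
sum-mWalk b = sum-walks≡fold-transfer mSteps (nextM b) (mWalk b) (λ _ → refl) (mWalk-∷ b)

pathsToAxis₂ : ℕ → ℕ → ℕ
pathsToAxis₂ = fold (δ 0) transfer₂

sum-walk12 : ∀ f {m} (qs : List (Vec Step2 m)) x →
  sum (map (maybe′ f 0 ∘ walk12 x) qs) ≡ maybe′ (λ h → sum (map (maybe′ f 0 ∘ walk2 h) qs)) 0 x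
sum-walk12 f qs (just h) = refl
sum-walk12 f qs nothing  = sum-map-0 qs

CR≡fold : ∀ n k → CR n k ≡ fold (pathsToAxis₂ (n ∸ k)) transfer₁ (2 * k) 0
CR≡fold n k = begin
  CR n k
    ≡⟨ length-filter-endsAt0 (λ pq → walk12 (walk1 0 (proj₁ pq)) (proj₂ pq)) (cartesianProduct ps qs) ⟩
  sum (map (λ pq → maybe′ (δ 0) 0 (walk12 (walk1 0 (proj₁ pq)) (proj₂ pq))) (cartesianProduct ps qs))
    ≡⟨ sum-map-cartesianProduct _ ps qs ⟩
  sum (map (λ p → sum (map (maybe′ (δ 0) 0 ∘ walk12 (walk1 0 p)) qs)) ps)
    ≡⟨ cong sum (map-cong (sum-walk12 (δ 0) qs ∘ walk1 0) ps) ⟩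
  sum (map (maybe′ (λ h → sum (map (maybe′ (δ 0) 0 ∘ walk2 h) qs)) 0 ∘ walk1 0) ps)
    ≡⟨ cong sum (map-cong (maybe′-cong (sum-walk2 (δ 0) (n ∸ k)) ∘ walk1 0) ps) ⟩
  sum (map (maybe′ (pathsToAxis₂ (n ∸ k)) 0 ∘ walk1 0) ps)
    ≡⟨ sum-walk1 _ (2 * k) 0 ⟩
  fold (pathsToAxis₂ (n ∸ k)) transfer₁ (2 * k) 0 ∎
  where
  ps = allVecs steps1 (2 * k)
  qs = allVecs steps2 (n ∸ k)

R≡fold : ∀ m → R m ≡ pathsToAxis₂ m 0
R≡fold m = begin
  R m
    ≡⟨ length-filter-endsAt0 (mWalk true 0) (allVecs mSteps m) ⟩
  sum (map (maybe′ (δ 0) 0 ∘ mWalk true 0) (allVecs mSteps m))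
    ≡⟨ sum-mWalk true (δ 0) m 0 ⟩
  fold (δ 0) (transferM true) m 0
    ≡⟨ fold-cong (transfer-cong mSteps (nextM true)) δ₀≗δ₀-even m 0 ⟩
  fold (δ 0 ∘ (_* 2)) (transferM true) m 0
    ≡⟨ fold-intertwine (_∘ (_* 2)) (transfer-cong mSteps (nextM true)) transfer₂-even (δ 0) m 0 ⟨
  pathsToAxis₂ m 0 ∎

M≡fold : ∀ m → M m ≡ fold (δ 1) transfer₂ m 1
M≡fold m = begin
  M m
    ≡⟨ length-filter-endsAt0 (mWalk false 0) (allVecs mSteps m) ⟩
  sum (map (maybe′ (δ 0) 0 ∘ mWalk false 0) (allVecs mSteps m))
    ≡⟨ sum-mWalk false (δ 0) m 0 ⟩
  fold (δ 0) (transferM false) m 0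
    ≡⟨ fold-cong (transfer-cong mSteps (nextM false)) δ₀≗δ₁-odd m 0 ⟩
  fold (δ 1 ∘ suc ∘ (_* 2)) (transferM false) m 0
    ≡⟨ fold-intertwine (_∘ suc ∘ (_* 2)) (transfer-cong mSteps (nextM false)) transfer₂-odd (δ 1) m 0 ⟨
  fold (δ 1) transfer₂ m 1 ∎

M≡transfer₁ : ∀ n → M n ≡ transfer₁ (pathsToAxis₂ n) 1
M≡transfer₁ n = begin
  M n
    ≡⟨ M≡fold n ⟩
  fold (δ 1) transfer₂ n 1
    ≡⟨ fold-cong (transfer-cong steps2 next₂) (sym ∘ transfer₁-δ₀) n 1 ⟩
  fold (transfer₁ (δ 0)) transfer₂ n 1
    ≡⟨ fold-intertwine transfer₁ (transfer-cong steps2 next₂) transfer₁-transfer₂-comm (δ 0) n 1 ⟨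
  transfer₁ (pathsToAxis₂ n) 1 ∎

R-suc+R≡transfer₁ : ∀ n → R (suc n) + R n ≡ transfer₁ (pathsToAxis₂ n) 1
R-suc+R≡transfer₁ n =
  trans (cong₂ _+_ (R≡fold (suc n)) (R≡fold n)) (rearrange (pathsToAxis₂ n 2) (pathsToAxis₂ n 0))
  where rearrange : ∀ a b → a + 0 + b ≡ a + (b + 0)
        rearrange = solve-∀

CR-recurrence : (n k : ℕ) → 1 ≤ k → k ≤ n → CR n k ≡ CR n (k ∸ 1) + CR (n ∸ 1) (k ∸ 1)
CR-recurrence (suc n) (suc k) _ (s≤s k≤n) = begin
  CR (suc n) (suc k)
    ≡⟨ CR≡fold (suc n) (suc k) ⟩
  fold (pathsToAxis₂ (n ∸ k)) transfer₁ (2 * suc k) 0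
    ≡⟨ cong (λ a → fold (pathsToAxis₂ (n ∸ k)) transfer₁ a 0) (*-suc 2 k) ⟩
  fold (pathsToAxis₂ (n ∸ k)) transfer₁ (2 + 2 * k) 0
    ≡⟨ fold-transfer₁-2+ (pathsToAxis₂ (n ∸ k)) (2 * k) 0 ⟩
  CRₖ (n ∸ k) + CRₖ (suc (n ∸ k))
    ≡⟨ +-comm (CRₖ (n ∸ k)) (CRₖ (suc (n ∸ k))) ⟩
  CRₖ (suc (n ∸ k)) + CRₖ (n ∸ k)
    ≡⟨ cong (λ b → CRₖ b + CRₖ (n ∸ k)) (+-∸-assoc 1 k≤n) ⟨
  CRₖ (suc n ∸ k) + CRₖ (n ∸ k)
    ≡⟨ cong₂ _+_ (CR≡fold (suc n) k) (CR≡fold n k) ⟨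
  CR (suc n) k + CR n k ∎
  where
  CRₖ : ℕ → ℕ
  CRₖ b = fold (pathsToAxis₂ b) transfer₁ (2 * k) 0

corollary3p4 : ((n k : ℕ) → 1 ≤ k → k ≤ n → CR n k ≡ CR n (k ∸ 1) + CR (n ∸ 1) (k ∸ 1))
             × ((n : ℕ) → (CR (suc n) 1 ≡ R (suc n) + R n) × (R (suc n) + R n ≡ M n))
corollary3p4 = CR-recurrence , λ n →
  trans (CR≡fold (suc n) 1) (trans (+-identityʳ _) (sym (R-suc+R≡transfer₁ n))) ,
  trans (R-suc+R≡transfer₁ n) (sym (M≡transfer₁ n))
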